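{- Let $k\ge 1$ and $t\ge 2$ be integers. Let $G$ be a graph whose vertex set has a partition $V(G)=A\cup B$ such that $G[A]\cong K_t$, $e(A,B)\ge k|B|$, there is at least one vertex $b\in B$ with $|N(b)\cap A|>k$, and $|B|>kt$. Then $G$ contains a path with at least $2k+1$ vertices whose two ends both lie in $A$ and which contains at least $k$ vertices of $B$.
   Context: All graphs are finite and simple. $G[A]$ is the subgraph induced by $A$, $N(b)$ is the set of neighbours of $b$, and $e(A,B)$ is the number of edges with one end in $A$ and the other in $B$. -}

module Defs where

open import Data.Nat using (ℕ; _+_)
open import Data.Bool using (Bool; true; false; _∧_; not; if_then_else_)
open import Data.Fin using (Fin)
open import Data.List using (List; []; _∷_; _∷ʳ_; length; map; allFin)
open import Data.Nat.ListAction using (sum)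
open import Data.List.Relation.Unary.Unique.Propositional using (Unique)
open import Data.List.Relation.Unary.Linked using (Linked)
open import Relation.Binary.PropositionalEquality using (_≡_; _≢_)
open import Data.Bool using (T)
open import Data.Product using (_×_)

record Graph (n : ℕ) : Set where
  field
    adj    : Fin n → Fin n → Bool
    sym    : ∀ u v → adj u v ≡ adj v u
    irrefl : ∀ v → adj v v ≡ false
open Graph public

count : ∀ {n} → (Fin n → Bool) → ℕ
count {n} f = sum (map (λ x → if f x then 1 else 0) (allFin n))

-- A vertex partition V = A ∪ B is given by the indicator inA of A
-- (B is the complement).

sizeB : ∀ {n} → (Fin n → Bool) → ℕ
sizeB inA = count (λ v → not (inA v))

sizeA : ∀ {n} → (Fin n → Bool) → ℕ
sizeA inA = count inA

eAB : ∀ {n} → Graph n → (Fin n → Bool) → ℕ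
eAB {n} G inA =
  sum (map (λ a → if inA a then count (λ b → not (inA b) ∧ adj G a b) else 0)
           (allFin n))

degA : ∀ {n} → Graph n → (Fin n → Bool) → Fin n → ℕ
degA G inA b = count (λ a → inA a ∧ adj G b a)

InducesComplete : ∀ {n} → Graph n → (Fin n → Bool) → ℕ → Set
InducesComplete G inA t =
  sizeA inA ≡ t × (∀ u v → T (inA u) → T (inA v) → u ≢ v → T (adj G u v))

IsPath : ∀ {n} → Graph n → List (Fin n) → Set
IsPath G p = Unique p × Linked (λ u v → T (adj G u v)) p

countB : ∀ {n} → (Fin n → Bool) → List (Fin n) → ℕ
countB inA p = sum (map (λ v → if inA v then 0 else 1) p)

-- Call a path a segment if both its ends lie in A and it has one more vertex in A than in B.
-- Start with the |A| one-vertex segments. A segment whose head is not adjacent to a vertex b of B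
-- contains at most as many A-neighbours of b as it has vertices in B, so if |N(b) ∩ A| exceeds the
-- number of B-vertices used so far by at least two, then b is adjacent to the heads of two distinct
-- segments; reversing one of them and joining the two through b uses one more vertex of B.
-- Double counting e(A,B) ≥ k|B| > k²t shows that, besides the given b₀ with |N(b₀) ∩ A| > k, B has
-- at least k vertices b with |N(b) ∩ A| ≥ k: absorbing k - 1 of them and finally b₀ leaves segments
-- covering A and k vertices of B, and since A is a clique they concatenate to a path on t + k ≥ 2k + 1
-- vertices with both ends in A.
module Submission where

open import Data.Bool using (Bool; true; false; T; not; _∧_; if_then_else_)
open import Data.Bool.Properties using (T-∧; ∧-zeroʳ)
open import Data.Empty using (⊥-elim)
open import Data.Fin using (Fin; _≟_)
open import Data.List
  using (List; []; _∷_; _++_; _ʳ++_; _∷ʳ_; [_]; concat; foldr; map; filter; take; length; head; last;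
         reverse; allFin; initLast; _∷ʳ′_)
open import Data.List.Properties using (++-assoc; ʳ++-defn; length-take; map-++; map-cong; concat-map-[_])
open import Data.List.Membership.Propositional using (_∈_)
open import Data.List.Membership.Propositional.Properties
  using (∈-∃++; ∈-filter⁺; ∈-filter⁻; ∈-allFin; ∈-++⁺ʳ)
open import Data.List.Relation.Binary.Subset.Propositional using (_⊆_)
open import Data.List.Relation.Binary.Permutation.Propositional
  using (_↭_; ↭-refl; ↭-sym; ↭-trans; ↭-reflexive; ↭⇒↭ₛ; module PermutationReasoning)
import Data.List.Relation.Binary.Permutation.Propositional as ↭
open import Data.List.Relation.Binary.Permutation.Propositional.Properties
  using (All-resp-↭; ∈-resp-↭; ↭-length; ↭-reverse; ++⁺ˡ; ++⁺ʳ; shift; shifts; map⁺)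
import Data.List.Relation.Binary.Permutation.Setoid.Properties as SetoidPerm
open import Data.List.Relation.Unary.All using (All; []; _∷_)
import Data.List.Relation.Unary.All as All
import Data.List.Relation.Unary.All.Properties as All
open import Data.List.Relation.Unary.AllPairs using ([]; _∷_)
open import Data.List.Relation.Unary.Any using (here; there)
open import Data.List.Relation.Unary.Linked using (Linked; []; [-]; _∷_)
import Data.List.Relation.Unary.Linked as Linked
import Data.List.Relation.Unary.Linked.Properties as Linked
open import Data.List.Relation.Unary.Unique.Propositional using (Unique)
import Data.List.Relation.Unary.Unique.Propositional.Properties as Unique
open import Data.Maybe using (just)
import Data.Maybe.Relation.Unary.All as Maybe
open Maybe using (just; nothing)
open import Data.Maybe.Relation.Binary.Connected using (Connected; just; just-nothing)
open import Data.Nat using (ℕ; suc; _+_; _*_; _≤_; _<_; _<ᵇ_; z≤n; s≤s; s≤s⁻¹; s<s⁻¹)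
open import Data.Nat.ListAction using (sum)
open import Data.Nat.ListAction.Properties using (sum-++; sum-↭)
open import Data.Nat.Properties
  using (≤-refl; ≤-reflexive; ≤-trans; ≤-<-trans; <-≤-trans; <⇒≤; ≮⇒≥; <⇒<ᵇ; <ᵇ⇒<;
         suc-injective; +-comm; +-assoc; +-suc; +-identityʳ; +-mono-≤; +-monoˡ-≤; +-monoʳ-≤;
         +-cancelʳ-≤; m≤m+n; m≤n+m;
         *-zeroʳ; *-identityʳ; *-distribˡ-+; *-monoʳ-≤; *-cancelʳ-<; m≤n⇒m⊓n≡m;
         +-commutativeSemigroup; module ≤-Reasoning)
open import Algebra.Properties.CommutativeSemigroup +-commutativeSemigroup using (interchange; x∙yz≈y∙xz)
open import Data.Nat.Tactic.RingSolver using (solve-∀)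
open import Data.Product using (_×_; _,_; proj₁; proj₂; ∃₂; ∃-syntax)
open import Data.Sum using (_⊎_; inj₁; inj₂)
open import Defs hiding (sym)
open import Function using (_∘_; _⟨_⟩_; Equivalence)
open import Relation.Binary.Definitions using (Symmetric)
open import Relation.Binary.PropositionalEquality
  using (_≡_; _≢_; ≢-sym; refl; sym; trans; cong; cong₂; subst; setoid; module ≡-Reasoning)
open import Relation.Nullary using (¬_; does; yes; no)
open import Relation.Nullary.Decidable using (T?; dec-true)

private
  variable
    A : Set
    x y : A
    xs ys : List A

indicator : Bool → ℕ
indicator b = if b then 1 else 0

indicator-T : ∀ {b} → T b → indicator b ≡ 1
indicator-T {true} _ = refl

indicator-≤-1 : ∀ b → indicator b ≤ 1
indicator-≤-1 true  = ≤-refl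
indicator-≤-1 false = z≤n

indicator-∧-≤ : ∀ a b → indicator (a ∧ b) ≤ indicator a
indicator-∧-≤ true  b = indicator-≤-1 b
indicator-∧-≤ false b = z≤n

sumMap : (A → ℕ) → List A → ℕ
sumMap f xs = sum (map f xs)

countBy : (A → Bool) → List A → ℕ
countBy p = sumMap (indicator ∘ p)

module _ (f : A → ℕ) where

  sumMap-++ : ∀ xs ys → sumMap f (xs ++ ys) ≡ sumMap f xs + sumMap f ys
  sumMap-++ xs ys = cong sum (map-++ f xs ys) ⟨ trans ⟩ sum-++ (map f xs) (map f ys)

  sumMap-↭ : xs ↭ ys → sumMap f xs ≡ sumMap f ys
  sumMap-↭ = sum-↭ ∘ map⁺ f

  sumMap-ʳ++ : ∀ xs ys → sumMap f (xs ʳ++ ys) ≡ sumMap f xs + sumMap f ys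
  sumMap-ʳ++ xs ys = begin
    sumMap f (xs ʳ++ ys)                ≡⟨ cong (sumMap f) (ʳ++-defn xs) ⟩
    sumMap f (reverse xs ++ ys)         ≡⟨ sumMap-++ (reverse xs) ys ⟩
    sumMap f (reverse xs) + sumMap f ys ≡⟨ cong (_+ sumMap f ys) (sumMap-↭ (↭-reverse xs)) ⟩
    sumMap f xs + sumMap f ys           ∎
    where open ≡-Reasoning

sumMap-cong : {f g : A → ℕ} → (∀ x → f x ≡ g x) → ∀ xs → sumMap f xs ≡ sumMap g xs
sumMap-cong f≗g xs = cong sum (map-cong f≗g xs)

sumMap-mono-≤ : {f g : A → ℕ} → (∀ x → f x ≤ g x) → ∀ xs → sumMap f xs ≤ sumMap g xs
sumMap-mono-≤ f≤g []       = z≤n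
sumMap-mono-≤ f≤g (x ∷ xs) = +-mono-≤ (f≤g x) (sumMap-mono-≤ f≤g xs)

sumMap-zero : {f : A → ℕ} → (∀ x → f x ≡ 0) → ∀ xs → sumMap f xs ≡ 0
sumMap-zero f≗0 []       = refl
sumMap-zero f≗0 (x ∷ xs) = cong₂ _+_ (f≗0 x) (sumMap-zero f≗0 xs)

sumMap-+ : ∀ (f g : A → ℕ) xs → sumMap (λ x → f x + g x) xs ≡ sumMap f xs + sumMap g xs
sumMap-+ f g []       = refl
sumMap-+ f g (x ∷ xs) = begin
  f x + g x + sumMap (λ x → f x + g x) xs  ≡⟨ cong (f x + g x +_) (sumMap-+ f g xs) ⟩
  f x + g x + (sumMap f xs + sumMap g xs)  ≡⟨ interchange (f x) (g x) (sumMap f xs) (sumMap g xs) ⟩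
  f x + sumMap f xs + (g x + sumMap g xs)  ∎
  where open ≡-Reasoning

sumMap-*ˡ : ∀ c (f : A → ℕ) xs → sumMap (λ x → c * f x) xs ≡ c * sumMap f xs
sumMap-*ˡ c f []       = sym (*-zeroʳ c)
sumMap-*ˡ c f (x ∷ xs) = cong (c * f x +_) (sumMap-*ˡ c f xs) ⟨ trans ⟩ sym (*-distribˡ-+ c (f x) _)

sumMap-swap : ∀ {B : Set} (f : A → B → ℕ) xs ys →
  sumMap (λ x → sumMap (f x) ys) xs ≡ sumMap (λ y → sumMap (λ x → f x y) xs) ys
sumMap-swap f []       ys = sym (sumMap-zero (λ _ → refl) ys)
sumMap-swap f (x ∷ xs) ys =
  cong (sumMap (f x) ys +_) (sumMap-swap f xs ys) ⟨ trans ⟩ sym (sumMap-+ (f x) _ ys)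

countBy-filter : ∀ (p : A → Bool) xs → countBy p xs ≡ length (filter (T? ∘ p) xs)
countBy-filter p []       = refl
countBy-filter p (x ∷ xs) with p x
... | true  = cong suc (countBy-filter p xs)
... | false = countBy-filter p xs

Unique-⊆⇒length-≤ : Unique xs → xs ⊆ ys → length xs ≤ length ys
Unique-⊆⇒length-≤ [] _ = z≤n
Unique-⊆⇒length-≤ {xs = x ∷ xs} (x∉xs ∷ uxs) xs⊆ys
  with us , vs , refl ← ∈-∃++ (xs⊆ys (here refl)) = begin
    suc (length xs)          ≤⟨ s≤s (Unique-⊆⇒length-≤ uxs xs⊆us++vs) ⟩
    suc (length (us ++ vs))  ≡⟨ ↭-length (↭-sym (shift x us vs)) ⟩
    length (us ++ x ∷ vs)    ∎
  where
  open ≤-Reasoning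
  xs⊆us++vs : xs ⊆ us ++ vs
  xs⊆us++vs y∈xs with ∈-resp-↭ (shift x us vs) (xs⊆ys (there y∈xs))
  ... | here refl = ⊥-elim (All.lookup x∉xs y∈xs refl)
  ... | there y∈  = y∈

countBy-mono-⊆ : ∀ (p : A → Bool) → Unique xs →
  (∀ {x} → x ∈ xs → T (p x) → x ∈ ys) → countBy p xs ≤ countBy p ys
countBy-mono-⊆ {xs = xs} {ys = ys} p uxs xs⊆ys = begin
  countBy p xs              ≡⟨ countBy-filter p xs ⟩
  length (filter p? xs)     ≤⟨ Unique-⊆⇒length-≤ (Unique.filter⁺ p? uxs) filter-⊆ ⟩
  length (filter p? ys)     ≡⟨ countBy-filter p ys ⟨
  countBy p ys              ∎
  where
  open ≤-Reasoning
  p? = T? ∘ p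
  filter-⊆ : filter p? xs ⊆ filter p? ys
  filter-⊆ x∈ with x∈xs , px ← ∈-filter⁻ p? x∈ = ∈-filter⁺ p? (xs⊆ys x∈xs px) px

countBy-witness : ∀ (p : A → Bool) xs → 1 ≤ countBy p xs → ∃₂ λ x ys → T (p x) × xs ↭ x ∷ ys
countBy-witness p (x ∷ xs) h with p x in px
... | true  = x , xs , subst T (sym px) _ , ↭-refl
... | false with y , ys , py , π ← countBy-witness p xs h =
  y , x ∷ ys , py , ↭-trans (↭.prep x π) (↭.swap x y ↭-refl)

countBy-↭-∷ : ∀ (p : A → Bool) → T (p x) → xs ↭ x ∷ ys → countBy p xs ≡ suc (countBy p ys)
countBy-↭-∷ {ys = ys} p px π =
  sumMap-↭ (indicator ∘ p) π ⟨ trans ⟩ cong (_+ countBy p ys) (indicator-T px)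

countBy-witness₂ : ∀ (p : A → Bool) xs → 2 ≤ countBy p xs →
  ∃[ x ] ∃[ y ] ∃[ zs ] (T (p x) × T (p y) × xs ↭ x ∷ y ∷ zs)
countBy-witness₂ p xs h
  with x , ys , px , π ← countBy-witness p xs (≤-trans (s≤s z≤n) h)
  with y , zs , py , ρ ← countBy-witness p ys (s≤s⁻¹ (subst (2 ≤_) (countBy-↭-∷ p px π) h))
  = x , y , zs , px , py , ↭-trans π (↭.prep x ρ)

Unique-resp-↭ : xs ↭ ys → Unique xs → Unique ys
Unique-resp-↭ π = SetoidPerm.Unique-resp-↭ (setoid _) (↭⇒↭ₛ π)

Linked-ʳ++⁺ : {R : A → A → Set} → Symmetric R →
  Linked R (x ∷ xs) → Linked R (x ∷ ys) → Linked R (xs ʳ++ x ∷ ys)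
Linked-ʳ++⁺ {xs = []}    sym _            Rys = Rys
Linked-ʳ++⁺ {xs = _ ∷ _} sym (Rxy ∷ Rxs) Rys = Linked-ʳ++⁺ sym Rxs (sym Rxy ∷ Rys)

head-ʳ++ : ∀ (x : A) xs ys → head (xs ʳ++ x ∷ ys) ≡ last (x ∷ xs)
head-ʳ++ x []       ys = refl
head-ʳ++ x (y ∷ xs) ys = head-ʳ++ y xs (x ∷ ys)

last-ʳ++ : ∀ xs (y : A) ys → last (xs ʳ++ y ∷ ys) ≡ last (y ∷ ys)
last-ʳ++ []       y ys = refl
last-ʳ++ (x ∷ xs) y ys = last-ʳ++ xs x (y ∷ ys)

last-∷ʳ : ∀ xs (x : A) → last (xs ∷ʳ x) ≡ just x
last-∷ʳ []           x = refl
last-∷ʳ (y ∷ [])     x = refl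
last-∷ʳ (y ∷ z ∷ xs) x = last-∷ʳ (z ∷ xs) x

last-∷ : {P : A → Set} → P x → Maybe.All P (last xs) → Maybe.All P (last (x ∷ xs))
last-∷ {xs = []}    px _   = just px
last-∷ {xs = _ ∷ _} _  pxs = pxs

ʳ++-↭ : ∀ (xs : List A) ys → xs ʳ++ ys ↭ xs ++ ys
ʳ++-↭ xs ys = ↭-trans (↭-reflexive (ʳ++-defn xs)) (++⁺ʳ ys (↭-reverse xs))

concat-↭ : {xss yss : List (List A)} → xss ↭ yss → concat xss ↭ concat yss
concat-↭ ↭.refl             = ↭-refl
concat-↭ (↭.prep xs π)      = ++⁺ˡ xs (concat-↭ π)
concat-↭ (↭.swap xs ys π)   = ↭-trans (shifts xs ys) (++⁺ˡ ys (++⁺ˡ xs (concat-↭ π)))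
concat-↭ (↭.trans π ρ)      = ↭-trans (concat-↭ π) (concat-↭ ρ)

concat-ʳ++-↭ : ∀ {xss} (x : A) xs ys zss → xss ↭ xs ∷ ys ∷ zss →
  concat ((xs ʳ++ x ∷ ys) ∷ zss) ↭ x ∷ concat xss
concat-ʳ++-↭ {xss = xss} x xs ys zss π = begin
  (xs ʳ++ x ∷ ys) ++ concat zss  ↭⟨ ++⁺ʳ (concat zss) (ʳ++-↭ xs (x ∷ ys)) ⟩
  (xs ++ x ∷ ys) ++ concat zss   ≡⟨ ++-assoc xs (x ∷ ys) (concat zss) ⟩
  xs ++ x ∷ ys ++ concat zss     ↭⟨ shift x xs (ys ++ concat zss) ⟩
  x ∷ concat (xs ∷ ys ∷ zss)     ↭⟨ ↭.prep x (concat-↭ (↭-sym π)) ⟩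
  x ∷ concat xss                 ∎
  where open PermutationReasoning

flatten : List (List A) → List A
flatten = foldr _ʳ++_ []

flatten-↭-concat : ∀ (xss : List (List A)) → flatten xss ↭ concat xss
flatten-↭-concat []         = ↭-refl
flatten-↭-concat (xs ∷ xss) = ↭-trans (ʳ++-↭ xs _) (++⁺ˡ xs (flatten-↭-concat xss))

double-counting-arith : ∀ k B t h → suc k * B ≤ k * B + t * h + t → suc k * t < B → k < h
double-counting-arith k B t h e≤ B> = s<s⁻¹ (*-cancelʳ-< t (suc k) (suc h) (<-≤-trans B> B≤))
  where
  rearrange : ∀ k B t h → k * B + t * h + t ≡ suc h * t + k * B
  rearrange = solve-∀
  B≤ : B ≤ suc h * t
  B≤ = +-cancelʳ-≤ (k * B) B (suc h * t) (≤-trans e≤ (≤-reflexive (rearrange k B t h)))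

-- Segments

module _ {n : ℕ} (G : Graph n) (inA : Fin n → Bool) where

  InA InB : Fin n → Set
  InA v = T (inA v)
  InB v = T (not (inA v))

  InA⇒¬InB : ∀ {v} → InA v → ¬ InB v
  InA⇒¬InB {v} v∈A v∈B with inA v
  ... | true = v∈B

  Adj : Fin n → Fin n → Set
  Adj u v = T (adj G u v)

  Adj-sym : Symmetric Adj
  Adj-sym {u} {v} = subst T (Graph.sym G u v)

  countA : List (Fin n) → ℕ
  countA = countBy inA

  countA-∷ᴮ : ∀ {b xs} → InB b → countA (b ∷ xs) ≡ countA xs
  countA-∷ᴮ {b} b∈B with inA b
  ... | false = refl

  countB-∷ᴮ : ∀ {b xs} → InB b → countB inA (b ∷ xs) ≡ suc (countB inA xs)
  countB-∷ᴮ {b} b∈B with inA b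
  ... | false = refl

  countA+countB : ∀ xs → countA xs + countB inA xs ≡ length xs
  countA+countB []       = refl
  countA+countB (x ∷ xs) with inA x
  ... | true  = cong suc (countA+countB xs)
  ... | false = +-suc (countA xs) (countB inA xs) ⟨ trans ⟩ cong suc (countA+countB xs)

  countB-allA : ∀ {xs} → All InA xs → countB inA xs ≡ 0
  countB-allA [] = refl
  countB-allA {x ∷ _} (x∈A ∷ xs⊆A) with inA x
  ... | true = countB-allA xs⊆A

  vertsA : List (Fin n)
  vertsA = filter (T? ∘ inA) (allFin n)

  CoversA : List (Fin n) → Set
  CoversA xs = ∀ {a} → InA a → a ∈ xs

  record IsSegment (s : List (Fin n)) : Set where
    field
      head∈A   : Maybe.All InA (head s)
      last∈A   : Maybe.All InA (last s)
      linked   : Linked Adj s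
      balanced : countA s ≡ suc (countB inA s)
  open IsSegment

  singleton-isSegment : ∀ {a} → InA a → IsSegment [ a ]
  singleton-isSegment {a} a∈A = record
    { head∈A = just a∈A ; last∈A = just a∈A ; linked = [-] ; balanced = balanced′ }
    where
    balanced′ : countA [ a ] ≡ suc (countB inA [ a ])
    balanced′ with inA a
    ... | true = refl

  adjToHead : Fin n → List (Fin n) → Bool
  adjToHead b []      = false
  adjToHead b (h ∷ _) = adj G b h

  join-isSegment : ∀ {b s₁ s₂} → InB b → T (adjToHead b s₁) → T (adjToHead b s₂) →
    IsSegment s₁ → IsSegment s₂ → IsSegment (s₁ ʳ++ b ∷ s₂)
  join-isSegment {b} {h₁ ∷ t₁} {h₂ ∷ t₂} b∈B b~h₁ b~h₂ seg₁ seg₂ = record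
    { head∈A   = subst (Maybe.All InA) (sym (head-ʳ++ h₁ t₁ (b ∷ s₂))) (last∈A seg₁)
    ; last∈A   = subst (Maybe.All InA) (sym (last-ʳ++ s₁ b s₂)) (last∈A seg₂)
    ; linked   = Linked-ʳ++⁺ Adj-sym (linked seg₁) (Adj-sym b~h₁ ∷ b~h₂ ∷ linked seg₂)
    ; balanced = begin
        countA (s₁ ʳ++ b ∷ s₂)
          ≡⟨ sumMap-ʳ++ _ s₁ (b ∷ s₂) ⟩
        countA s₁ + countA (b ∷ s₂)
          ≡⟨ cong₂ _+_ (balanced seg₁) (countA-∷ᴮ {xs = s₂} b∈B ⟨ trans ⟩ balanced seg₂) ⟩
        suc (countB inA s₁ + suc (countB inA s₂))
          ≡⟨ cong (λ m → suc (countB inA s₁ + m)) (countB-∷ᴮ {xs = s₂} b∈B) ⟨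
        suc (countB inA s₁ + countB inA (b ∷ s₂))
          ≡⟨ cong suc (sumMap-ʳ++ _ s₁ (b ∷ s₂)) ⟨
        suc (countB inA (s₁ ʳ++ b ∷ s₂))
          ∎
    }
    where
    open ≡-Reasoning
    s₁ = h₁ ∷ t₁
    s₂ = h₂ ∷ t₂

  -- Absorbing vertices of B

  nbrInA : Fin n → Fin n → Bool
  nbrInA b v = inA v ∧ adj G b v

  nbrInA-segment-≤ : ∀ {b s} → IsSegment s →
    countBy (nbrInA b) s ≤ countB inA s + indicator (adjToHead b s)
  nbrInA-segment-≤ {s = []} record { balanced = () }
  nbrInA-segment-≤ {b} {h ∷ t} record { head∈A = just h∈A ; balanced = balanced′ }
    with inA h | h∈A | balanced′
  ... | true | _ | balanced″ = begin
    indicator (adj G b h) + countBy (nbrInA b) t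
      ≡⟨ +-comm _ (countBy (nbrInA b) t) ⟩
    countBy (nbrInA b) t + indicator (adj G b h)
      ≤⟨ +-monoˡ-≤ _ (sumMap-mono-≤ (λ v → indicator-∧-≤ (inA v) _) t) ⟩
    countA t + indicator (adj G b h)
      ≡⟨ cong (_+ _) (suc-injective balanced″) ⟩
    countB inA t + indicator (adj G b h)
      ∎
    where open ≤-Reasoning

  nbrInA-concat-≤ : ∀ {b ss} → All IsSegment ss →
    countBy (nbrInA b) (concat ss) ≤ countB inA (concat ss) + countBy (adjToHead b) ss
  nbrInA-concat-≤ {ss = []} [] = z≤n
  nbrInA-concat-≤ {b} {s ∷ ss} (seg ∷ segs) = begin
    countBy (nbrInA b) (s ++ concat ss)
      ≡⟨ sumMap-++ _ s (concat ss) ⟩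
    countBy (nbrInA b) s + countBy (nbrInA b) (concat ss)
      ≤⟨ +-mono-≤ (nbrInA-segment-≤ seg) (nbrInA-concat-≤ segs) ⟩
    countB inA s + indicator (adjToHead b s) + (countB inA (concat ss) + countBy (adjToHead b) ss)
      ≡⟨ interchange (countB inA s) (indicator (adjToHead b s)) (countB inA (concat ss)) _ ⟩
    countB inA s + countB inA (concat ss) + countBy (adjToHead b) (s ∷ ss)
      ≡⟨ cong (_+ countBy (adjToHead b) (s ∷ ss)) (sumMap-++ _ s (concat ss)) ⟨
    countB inA (s ++ concat ss) + countBy (adjToHead b) (s ∷ ss)
      ∎
    where open ≤-Reasoning

  degA-≤-nbrInA : ∀ {b xs} → CoversA xs → degA G inA b ≤ countBy (nbrInA b) xs
  degA-≤-nbrInA {b} covers =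
    countBy-mono-⊆ (nbrInA b) (Unique.allFin⁺ n) (λ _ a~b → covers (proj₁ (Equivalence.to T-∧ a~b)))

  adjToHead-≥2 : ∀ {ss X b} → All IsSegment ss → concat ss ↭ X → CoversA X →
    suc (countB inA X) < degA G inA b → 2 ≤ countBy (adjToHead b) ss
  adjToHead-≥2 {ss} {X} {b} segs π covers deg> = +-cancelʳ-≤ (countB inA X) 2 _ (begin
    2 + countB inA X                                   ≤⟨ deg> ⟩
    degA G inA b                                       ≤⟨ degA-≤-nbrInA covers ⟩
    countBy (nbrInA b) X                               ≡⟨ sumMap-↭ _ π ⟨
    countBy (nbrInA b) (concat ss)                     ≤⟨ nbrInA-concat-≤ segs ⟩
    countB inA (concat ss) + countBy (adjToHead b) ss  ≡⟨ cong (_+ _) (sumMap-↭ _ π) ⟩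
    countB inA X + countBy (adjToHead b) ss            ≡⟨ +-comm (countB inA X) _ ⟩
    countBy (adjToHead b) ss + countB inA X            ∎)
    where open ≤-Reasoning

  augment : ∀ {ss X b} → All IsSegment ss → concat ss ↭ X → CoversA X → InB b →
    suc (countB inA X) < degA G inA b →
    ∃[ ss′ ] (All IsSegment ss′ × concat ss′ ↭ b ∷ X)
  augment {ss} {X} {b} segs π covers b∈B deg>
    with s₁ , s₂ , rest , b~s₁ , b~s₂ , ρ
           ← countBy-witness₂ (adjToHead b) ss (adjToHead-≥2 segs π covers deg>)
    with seg₁ ∷ seg₂ ∷ segs′ ← All-resp-↭ ρ segs
    = (s₁ ʳ++ b ∷ s₂) ∷ rest
    , join-isSegment b∈B b~s₁ b~s₂ seg₁ seg₂ ∷ segs′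
    , ↭-trans (concat-ʳ++-↭ b s₁ s₂ rest ρ) (↭.prep b π)

  augmentAll : ∀ {ss X} bs → All IsSegment ss → concat ss ↭ X → CoversA X → All InB bs →
    All (λ b → length bs + countB inA X < degA G inA b) bs →
    ∃[ ss′ ] (All IsSegment ss′ × concat ss′ ↭ bs ++ X)
  augmentAll [] segs π _ _ _ = _ , segs , π
  augmentAll {X = X} (b ∷ bs) segs π covers (b∈B ∷ bs⊆B) (deg-b ∷ degs)
    with ss₁ , segs₁ , π₁ ← augment segs π covers b∈B (≤-<-trans (s≤s (m≤n+m _ (length bs))) deg-b)
    with ss₂ , segs₂ , π₂ ← augmentAll bs segs₁ π₁ (there ∘ covers) bs⊆B
           (All.map (λ {b′} → subst (_< degA G inA b′)
              (sym (cong (length bs +_) (countB-∷ᴮ {xs = X} b∈B) ⟨ trans ⟩ +-suc (length bs) _))) degs)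
    = ss₂ , segs₂ , ↭-trans π₂ (shift b bs X)

  vertsA-covers : CoversA vertsA
  vertsA-covers a∈A = ∈-filter⁺ (T? ∘ inA) (∈-allFin _) a∈A

  countB-vertsA : countB inA vertsA ≡ 0
  countB-vertsA = countB-allA (All.all-filter (T? ∘ inA) (allFin n))

  countB-++-vertsA : ∀ {bs} → All InB bs → countB inA (bs ++ vertsA) ≡ length bs
  countB-++-vertsA [] = countB-vertsA
  countB-++-vertsA {b ∷ bs} (b∈B ∷ bs⊆B) =
    countB-∷ᴮ {xs = bs ++ vertsA} b∈B ⟨ trans ⟩ cong suc (countB-++-vertsA bs⊆B)

  Unique-++-vertsA : ∀ {bs} → Unique bs → All InB bs → Unique (bs ++ vertsA)
  Unique-++-vertsA unique bs⊆B = Unique.++⁺ unique (Unique.filter⁺ (T? ∘ inA) (Unique.allFin⁺ n))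
    λ (v∈bs , v∈A) →
      InA⇒¬InB (proj₂ (∈-filter⁻ (T? ∘ inA) {xs = allFin n} v∈A)) (All.lookup bs⊆B v∈bs)

  singletons-isSegment : All IsSegment (map [_] vertsA)
  singletons-isSegment = All.map⁺ (All.map singleton-isSegment (All.all-filter (T? ∘ inA) (allFin n)))

  segments-through : ∀ {b₀} bs → All InB (b₀ ∷ bs) → All (λ b → length bs < degA G inA b) bs →
    suc (length bs) < degA G inA b₀ → ∃[ ss ] (All IsSegment ss × concat ss ↭ b₀ ∷ bs ++ vertsA)
  segments-through bs (b₀∈B ∷ bs⊆B) degs deg₀
    with ss , segs , π
           ← augmentAll bs singletons-isSegment (↭-reflexive (concat-map-[ vertsA ])) vertsA-covers bs⊆B
               (All.map (subst (_< _) (sym (cong (length bs +_) countB-vertsA ⟨ trans ⟩ +-identityʳ _))) degs)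
    = augment segs π (∈-++⁺ʳ bs ∘ vertsA-covers) b₀∈B
        (subst (λ m → suc m < degA G inA _) (sym (countB-++-vertsA bs⊆B)) deg₀)

  -- Concatenating the segments

  Clique : Set
  Clique = ∀ u v → InA u → InA v → u ≢ v → Adj u v

  AdjOrInA : Fin n → Fin n → Set
  AdjOrInA u v = Adj u v ⊎ (InA u × InA v)

  AdjOrInA-sym : Symmetric AdjOrInA
  AdjOrInA-sym (inj₁ u~v)        = inj₁ (Adj-sym u~v)
  AdjOrInA-sym (inj₂ (u∈A , v∈A)) = inj₂ (v∈A , u∈A)

  flatten-head∈A : ∀ {ss} → All IsSegment ss → Maybe.All InA (head (flatten ss))
  flatten-head∈A [] = nothing
  flatten-head∈A {(h ∷ t) ∷ ss} (seg ∷ _) =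
    subst (Maybe.All InA) (sym (head-ʳ++ h t (flatten ss))) (last∈A seg)

  flatten-last∈A : ∀ {ss} → All IsSegment ss → Maybe.All InA (last (flatten ss))
  flatten-last∈A [] = nothing
  flatten-last∈A {(h ∷ t) ∷ ss} (record { head∈A = just h∈A } ∷ segs) =
    subst (Maybe.All InA) (sym (last-ʳ++ t h (flatten ss)))
      (last-∷ {xs = flatten ss} h∈A (flatten-last∈A segs))

  -- Consecutive segments of the flattening meet at two vertices of A, which the clique joins.
  flatten-linked : ∀ {ss} → All IsSegment ss → Linked AdjOrInA (flatten ss)
  flatten-linked [] = []
  flatten-linked {(h ∷ t) ∷ ss} (seg@record { head∈A = just h∈A } ∷ segs) =
    Linked-ʳ++⁺ AdjOrInA-sym (Linked.map inj₁ (linked seg))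
      (Linked.++⁺ [-] (connect (flatten-head∈A segs)) (flatten-linked segs))
    where
    connect : ∀ {m} → Maybe.All InA m → Connected AdjOrInA (just h) m
    connect (just v∈A) = just (inj₂ (h∈A , v∈A))
    connect nothing    = just-nothing

  flatten-isPath : ∀ {ss} → Clique → All IsSegment ss → Unique (concat ss) → IsPath G (flatten ss)
  flatten-isPath {ss} clique segs unique =
    unique′ , Linked.zipWith edge (flatten-linked segs , Linked.AllPairs⇒Linked unique′)
    where
    unique′ = Unique-resp-↭ (↭-sym (flatten-↭-concat ss)) unique
    edge : ∀ {u v} → AdjOrInA u v × u ≢ v → Adj u v
    edge (inj₁ u~v , _)            = u~v
    edge (inj₂ (u∈A , v∈A) , u≢v) = clique _ _ u∈A v∈A u≢v

  LongABPath : ℕ → Set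
  LongABPath k = ∃[ a ] ∃[ mid ] ∃[ c ]
    (IsPath G (a ∷ (mid ∷ʳ c)) × T (inA a) × T (inA c)
      × 2 * k + 1 ≤ length (a ∷ (mid ∷ʳ c))
      × k ≤ countB inA (a ∷ (mid ∷ʳ c)))

  path⇒LongABPath : ∀ {k} p → IsPath G p → Maybe.All InA (head p) → Maybe.All InA (last p) →
    2 ≤ length p → 2 * k + 1 ≤ length p → k ≤ countB inA p → LongABPath k
  path⇒LongABPath (a ∷ p) path (just a∈A) last∈A′ two≤ long many with initLast p | two≤
  ... | [] | s≤s ()
  ... | mid ∷ʳ′ c | _ =
    a , mid , c , path , a∈A
    , Maybe.drop-just (subst (Maybe.All InA) (last-∷ʳ (a ∷ mid) c) last∈A′) , long , many

  countA-concat : ∀ {ss} → All IsSegment ss → countA (concat ss) ≡ length ss + countB inA (concat ss)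
  countA-concat {[]} [] = refl
  countA-concat {s ∷ ss} (seg ∷ segs) = begin
    countA (s ++ concat ss)
      ≡⟨ sumMap-++ _ s (concat ss) ⟩
    countA s + countA (concat ss)
      ≡⟨ cong₂ _+_ (balanced seg) (countA-concat segs) ⟩
    suc (countB inA s + (length ss + countB inA (concat ss)))
      ≡⟨ cong suc (x∙yz≈y∙xz (countB inA s) (length ss) _) ⟩
    suc (length ss + (countB inA s + countB inA (concat ss)))
      ≡⟨ cong (suc ∘ (length ss +_)) (sumMap-++ _ s (concat ss)) ⟨
    suc (length ss + countB inA (s ++ concat ss))
      ∎
    where open ≡-Reasoning

  segments⇒LongABPath : ∀ {ss} → Clique → All IsSegment ss → Unique (concat ss) →
    1 ≤ countB inA (concat ss) → LongABPath (countB inA (concat ss))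
  segments⇒LongABPath {[]} _ _ _ ()
  segments⇒LongABPath {ss@(_ ∷ _)} clique segs unique c≥1 =
    path⇒LongABPath (flatten ss) (flatten-isPath clique segs unique)
      (flatten-head∈A segs) (flatten-last∈A segs)
      (≤-trans (*-monoʳ-≤ 2 c≥1) (≤-trans (m≤m+n _ 1) long)) long (≤-reflexive (sym (sumMap-↭ _ π)))
    where
    π = flatten-↭-concat ss
    c = countB inA (concat ss)
    long : 2 * c + 1 ≤ length (flatten ss)
    long = begin
      2 * c + 1               ≤⟨ +-monoʳ-≤ (2 * c) (s≤s z≤n) ⟩
      2 * c + length ss       ≡⟨ +-comm (2 * c) (length ss) ⟩
      length ss + 2 * c       ≡⟨ cong (λ m → length ss + (c + m)) (+-identityʳ c) ⟩
      length ss + (c + c)     ≡⟨ +-assoc (length ss) c c ⟨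
      length ss + c + c       ≡⟨ cong (_+ c) (countA-concat segs) ⟨
      countA (concat ss) + c  ≡⟨ countA+countB (concat ss) ⟩
      length (concat ss)      ≡⟨ ↭-length π ⟨
      length (flatten ss)     ∎
      where open ≤-Reasoning

  -- Double counting

  eAB≡sum-degA : eAB G inA ≡ sumMap (λ b → if inA b then 0 else degA G inA b) (allFin n)
  eAB≡sum-degA = begin
    eAB G inA
      ≡⟨ sumMap-cong row (allFin n) ⟩
    sumMap (λ a → sumMap (λ b → edgeAB a b) (allFin n)) (allFin n)
      ≡⟨ sumMap-swap edgeAB (allFin n) (allFin n) ⟩
    sumMap (λ b → sumMap (λ a → edgeAB a b) (allFin n)) (allFin n)
      ≡⟨ sumMap-cong column (allFin n) ⟩
    sumMap (λ b → if inA b then 0 else degA G inA b) (allFin n)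
      ∎
    where
    open ≡-Reasoning
    edgeAB : Fin n → Fin n → ℕ
    edgeAB a b = indicator (inA a ∧ (not (inA b) ∧ adj G a b))
    row : ∀ a → (if inA a then count (λ b → not (inA b) ∧ adj G a b) else 0) ≡ sumMap (edgeAB a) (allFin n)
    row a with inA a
    ... | true  = refl
    ... | false = sym (sumMap-zero (λ _ → refl) (allFin n))
    column : ∀ b → sumMap (λ a → edgeAB a b) (allFin n) ≡ (if inA b then 0 else degA G inA b)
    column b with inA b
    ... | true  = sumMap-zero (λ a → cong indicator (∧-zeroʳ (inA a))) (allFin n)
    ... | false = sumMap-cong (λ a → cong (λ e → indicator (inA a ∧ e)) (Graph.sym G a b)) (allFin n)

  degA-≤-sizeA : ∀ b → degA G inA b ≤ sizeA inA
  degA-≤-sizeA b = sumMap-mono-≤ (λ a → indicator-∧-≤ (inA a) (adj G b a)) (allFin n)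

  highDegreeB : ℕ → Fin n → Fin n → Bool
  highDegreeB k b₀ b = not (inA b) ∧ (k <ᵇ degA G inA b) ∧ not (does (b ≟ b₀))

  highDegreeB-sound : ∀ {k b₀ b} → T (highDegreeB k b₀ b) → InB b × k < degA G inA b × b ≢ b₀
  highDegreeB-sound {k} {b₀} {b} h
    with b∈B , h′ ← Equivalence.to T-∧ h
    with k<d , b≢b₀ ← Equivalence.to T-∧ h′
    = b∈B , <ᵇ⇒< k _ k<d , λ b≡b₀ → subst (T ∘ not) (dec-true (b ≟ b₀) b≡b₀) b≢b₀

  degA-split : ∀ {k t} b₀ → (∀ b → degA G inA b ≤ t) → ∀ b →
    (if inA b then 0 else degA G inA b) ≤
      k * indicator (not (inA b)) + t * indicator (highDegreeB k b₀ b) + t * indicator (does (b ≟ b₀))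
  degA-split {k} {t} b₀ deg≤t b with inA b | k <ᵇ degA G inA b in k≮d | b ≟ b₀
  ... | true  | _     | _     = z≤n
  ... | false | false | _     = begin
    degA G inA b          ≤⟨ ≮⇒≥ (subst T k≮d ∘ <⇒<ᵇ) ⟩
    k                     ≡⟨ *-identityʳ k ⟨
    k * 1                 ≤⟨ m≤m+n _ _ ⟩
    k * 1 + t * 0         ≤⟨ m≤m+n _ _ ⟩
    k * 1 + t * 0 + _     ∎
    where open ≤-Reasoning
  ... | false | true  | yes _ = begin
    degA G inA b          ≤⟨ deg≤t b ⟩
    t                     ≡⟨ *-identityʳ t ⟨
    t * 1                 ≤⟨ m≤n+m _ _ ⟩
    k * 1 + t * 0 + t * 1 ∎
    where open ≤-Reasoning
  ... | false | true  | no _  = begin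
    degA G inA b          ≤⟨ deg≤t b ⟩
    t                     ≡⟨ *-identityʳ t ⟨
    t * 1                 ≤⟨ m≤n+m _ (k * 1) ⟩
    k * 1 + t * 1         ≤⟨ m≤m+n _ _ ⟩
    k * 1 + t * 1 + t * 0 ∎
    where open ≤-Reasoning

  countBy-≟-≤-1 : ∀ b₀ → countBy (λ b → does (b ≟ b₀)) (allFin n) ≤ 1
  countBy-≟-≤-1 b₀ =
    ≤-trans (countBy-mono-⊆ {ys = [ b₀ ]} _ (Unique.allFin⁺ n) (λ {b} _ → here ∘ ≟-sound b))
      (≤-trans (≤-reflexive (+-identityʳ _)) (indicator-≤-1 _))
    where
    ≟-sound : ∀ b → T (does (b ≟ b₀)) → b ≡ b₀
    ≟-sound b _ with b ≟ b₀
    ... | yes b≡b₀ = b≡b₀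

  eAB-≤ : ∀ {k t} b₀ → sizeA inA ≡ t →
    eAB G inA ≤ k * sizeB inA + t * countBy (highDegreeB k b₀) (allFin n) + t
  eAB-≤ {k} {t} b₀ |A|≡t = begin
    eAB G inA
      ≡⟨ eAB≡sum-degA ⟩
    sumMap (λ b → if inA b then 0 else degA G inA b) (allFin n)
      ≤⟨ sumMap-mono-≤ (degA-split b₀ deg≤t) (allFin n) ⟩
    sumMap (λ b → k * inB b + t * high b + t * is-b₀ b) (allFin n)
      ≡⟨ sumMap-+ (λ b → k * inB b + t * high b) (λ b → t * is-b₀ b) (allFin n) ⟩
    sumMap (λ b → k * inB b + t * high b) (allFin n) + sumMap (λ b → t * is-b₀ b) (allFin n)
      ≡⟨ cong₂ _+_ (sumMap-+ (λ b → k * inB b) (λ b → t * high b) (allFin n))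
                   (sumMap-*ˡ t is-b₀ (allFin n)) ⟩
    sumMap (λ b → k * inB b) (allFin n) + sumMap (λ b → t * high b) (allFin n) + t * sumMap is-b₀ (allFin n)
      ≡⟨ cong₂ (λ x y → x + y + t * sumMap is-b₀ (allFin n))
               (sumMap-*ˡ k inB (allFin n)) (sumMap-*ˡ t high (allFin n)) ⟩
    k * sizeB inA + t * countBy (highDegreeB k b₀) (allFin n) + t * sumMap is-b₀ (allFin n)
      ≤⟨ +-monoʳ-≤ _ (*-monoʳ-≤ t (countBy-≟-≤-1 b₀)) ⟩
    k * sizeB inA + t * countBy (highDegreeB k b₀) (allFin n) + t * 1
      ≡⟨ cong (k * sizeB inA + t * countBy (highDegreeB k b₀) (allFin n) +_) (*-identityʳ t) ⟩
    k * sizeB inA + t * countBy (highDegreeB k b₀) (allFin n) + t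
      ∎
    where
    open ≤-Reasoning
    inB high is-b₀ : Fin n → ℕ
    inB b = indicator (not (inA b))
    high b = indicator (highDegreeB k b₀ b)
    is-b₀ b = indicator (does (b ≟ b₀))
    deg≤t : ∀ b → degA G inA b ≤ t
    deg≤t b = ≤-trans (degA-≤-sizeA b) (≤-reflexive |A|≡t)

  highDegree-vertices : ∀ {k t} b₀ → sizeA inA ≡ t →
    suc k * sizeB inA ≤ eAB G inA → suc k * t < sizeB inA →
    ∃[ bs ] (length bs ≡ k × Unique (b₀ ∷ bs) × All InB bs × All (λ b → k < degA G inA b) bs)
  highDegree-vertices {k} {t} b₀ |A|≡t e≥ B> =
      take k hs
    , (length-take k hs ⟨ trans ⟩ m≤n⇒m⊓n≡m (<⇒≤ (subst (k <_) (countBy-filter _ (allFin n)) many)))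
    , All.map (≢-sym ∘ proj₂ ∘ proj₂) sound ∷ Unique.take⁺ k (Unique.filter⁺ _ (Unique.allFin⁺ n))
    , All.map proj₁ sound
    , All.map (proj₁ ∘ proj₂) sound
    where
    hs = filter (T? ∘ highDegreeB k b₀) (allFin n)
    many : k < countBy (highDegreeB k b₀) (allFin n)
    many = double-counting-arith k (sizeB inA) t _ (≤-trans e≥ (eAB-≤ b₀ |A|≡t)) B>
    sound : All (λ b → InB b × k < degA G inA b × b ≢ b₀) (take k hs)
    sound = All.take⁺ k (All.map highDegreeB-sound (All.all-filter _ (allFin n)))

  longABPath-through : ∀ {k b₀ bs} → Clique →
    length bs ≡ k → Unique (b₀ ∷ bs) → All InB (b₀ ∷ bs) →
    All (λ b → k < degA G inA b) bs → suc k < degA G inA b₀ → LongABPath (suc k)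
  longABPath-through {bs = bs} clique refl unique bs⊆B degs deg₀ =
    let ss , segs , π = segments-through bs bs⊆B degs deg₀
        countB≡ = sumMap-↭ _ π ⟨ trans ⟩ countB-++-vertsA bs⊆B
    in subst LongABPath countB≡ (segments⇒LongABPath clique segs
         (Unique-resp-↭ (↭-sym π) (Unique-++-vertsA unique bs⊆B)) (subst (1 ≤_) (sym countB≡) (s≤s z≤n)))

lemma2p5 : (k t : ℕ) → 1 ≤ k → 2 ≤ t →
    (n : ℕ) (G : Graph n) (inA : Fin n → Bool) →
    InducesComplete G inA t →
    k * sizeB inA ≤ eAB G inA →
    (∃[ b ] (T (not (inA b)) × k < degA G inA b)) →
    k * t < sizeB inA →
    ∃[ a ] ∃[ mid ] ∃[ c ]
      (IsPath G (a ∷ (mid ∷ʳ c)) × T (inA a) × T (inA c)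
        × 2 * k + 1 ≤ length (a ∷ (mid ∷ʳ c))
        × k ≤ countB inA (a ∷ (mid ∷ʳ c)))
lemma2p5 (suc k) t _ _ n G inA (|A|≡t , clique) e≥ (b₀ , b₀∈B , k<deg) B> =
  let bs , |bs|≡k , unique , bs⊆B , degs = highDegree-vertices G inA b₀ |A|≡t e≥ B>
  in longABPath-through G inA clique |bs|≡k unique (b₀∈B ∷ bs⊆B) degs k<deg
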